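{- Let $k\ge2$ and $n\ge1$ be integers. If there is a family of $S$ permutations of $[n^{k-1}]$ that shatters every $k$-element subset of $[n^{k-1}]$, then there is (explicitly constructible) a family of $kS$ permutations of $[n^k]$ that shatters every $k$-element subset of $[n^k]$.
   Context: $S_N$ is the set of permutations of $[N]$, viewed as linear orderings of $[N]$. For $P\in S_N$ and a $k$-element $X\subseteq[N]$, $P_X\in S_k$ is the pattern (relative order) of $X$ in $P$. A family $\mathcal S\subseteq S_N$ shatters $X$ if $\{P_X:P\in\mathcal S\}=S_k$, i.e. every one of the $k!$ orderings of $X$ appears as the restriction to $X$ of some member of $\mathcal S$. -}

module Defs where

open import Data.Nat using (ℕ)
open import Data.Fin using (Fin; _<_)
open import Data.Fin.Permutation using (Permutation′; _⟨$⟩ʳ_)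
open import Data.Product using (∃)
open import Relation.Binary.PropositionalEquality using (_≡_)
open import Function.Definitions using (Injective)

-- A permutation P of [N] is viewed as a linear order: P ⟨$⟩ʳ a is the position of a.
-- A family of S permutations of [N] is an S-indexed family  Fin S → Permutation′ N.

-- A k-element subset X of [N] is given by an injective enumeration x : Fin k → Fin N.
-- An ordering of X is given by σ : Permutation′ k, listing X as x (σ 0), x (σ 1), ...
Realises : ∀ {N k} → Permutation′ N → (Fin k → Fin N) → Permutation′ k → Set
Realises P x σ = ∀ i j → i < j → P ⟨$⟩ʳ (x (σ ⟨$⟩ʳ i)) < P ⟨$⟩ʳ (x (σ ⟨$⟩ʳ j))

Shatters : ∀ {S N k} → (Fin S → Permutation′ N) → (Fin k → Fin N) → Set
Shatters {k = k} F x = (σ : Permutation′ k) → ∃ λ s → Realises (F s) x σ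

ShattersAll : ∀ {S N} → (k : ℕ) → (Fin S → Permutation′ N) → Set
ShattersAll {N = N} k F =
  (x : Fin k → Fin N) → Injective _≡_ _≡_ x → Shatters F x

-- Identify [n^k] with the words of length k over [n]. Among any k distinct words of
-- length k there is a coordinate whose deletion keeps them distinct (a Bondy-type
-- fact). For every coordinate i and every member π of the given family, order [n^k]
-- lexicographically: first by π applied to the word with coordinate i deleted (a point
-- of [n^(k-1)]), then by the deleted letter. Given a k-set X, choose i so that deletion
-- is injective on X; then the pattern of X in the new order is that of its image in π,
-- so the k·S orders shatter X.
module Submission where

open import Defs
open import Data.Nat as ℕ using (ℕ; zero; suc; _≤_; _*_; _^_; _∸_; s≤s)
open import Data.Nat.Properties using (≤-refl)
open import Data.Fin using (Fin; zero; suc; punchIn; punchOut; combine; remQuot; finToFun; funToFin; _<_)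
open import Data.Fin.Properties using (any?; punchIn-punchOut; toℕ-cast; combine-monoˡ-<; remQuot-combine; finToFun-funToFin; funToFin-finToFin; *↔×)
import Data.Fin.Properties as Fin
open import Data.Fin.Permutation using (Permutation′; _⟨$⟩ʳ_; _∘ₚ_; cast-id; ↔⇒≡)
open import Data.Vec using (Vec; _∷_; lookup; tabulate; removeAt; insertAt)
open import Data.Vec.Properties using (≡-dec; ∷-injective; tabulate-cong; tabulate∘lookup; lookup∘tabulate; removeAt-insertAt; insertAt-removeAt; insertAt-lookup)
open import Data.Product using (∃; ∃₂; _×_; _,_; proj₁; proj₂; map; map₂)
open import Data.Product.Function.NonDependent.Propositional using (_×-↔_)
open import Function using (_∘_; _↔_; Inverse; Injection; mk↔ₛ′)
open import Function.Definitions using (Injective)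
open import Function.Properties.Inverse using (↔-refl; ↔-sym; ↔-trans; ↔⇒↣)
open import Relation.Binary.Definitions using (DecidableEquality)
open import Relation.Binary.PropositionalEquality
open import Relation.Nullary using (¬_; Dec; yes; no; ¬?; _×-dec_; contradiction)
open import Relation.Nullary.Decidable using (decidable-stable)

module _ {a} {A : Set a} (_≟_ : DecidableEquality A) where

  RemoveAtInjective : ∀ {t d} → (Fin t → Vec A (suc d)) → Fin (suc d) → Set a
  RemoveAtInjective p i = ∀ b c → removeAt (p b) i ≡ removeAt (p c) i → p b ≡ p c

  TailCollision : ∀ {t d} → (Fin t → Vec A (suc d)) → Set a
  TailCollision p = ∃₂ λ b c → removeAt (p b) zero ≡ removeAt (p c) zero × p b ≢ p c

  private
    _≟ᵥ_ : ∀ {d} → DecidableEquality (Vec A d)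
    _≟ᵥ_ = ≡-dec _≟_

  tailCollision? : ∀ {t d} (p : Fin t → Vec A (suc d)) → Dec (TailCollision p)
  tailCollision? p = any? λ b → any? λ c →
    (removeAt (p b) zero ≟ᵥ removeAt (p c) zero) ×-dec ¬? (p b ≟ᵥ p c)

  ¬TailCollision⇒RemoveAtInjective : ∀ {t d} (p : Fin t → Vec A (suc d)) →
                                     ¬ TailCollision p → RemoveAtInjective p zero
  ¬TailCollision⇒RemoveAtInjective p noCollision b c eq =
    decidable-stable (p b ≟ᵥ p c) λ neq → noCollision (b , c , eq , neq)

  removeAt-suc-cancel : ∀ {d} (u w : Vec A (suc (suc d))) j →
                        removeAt u (suc j) ≡ removeAt w (suc j) →
                        (removeAt (removeAt u zero) j ≡ removeAt (removeAt w zero) j →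
                         removeAt u zero ≡ removeAt w zero) →
                        u ≡ w
  removeAt-suc-cancel (x ∷ xs@(_ ∷ _)) (y ∷ ys@(_ ∷ _)) j eq tail-inj
    with refl , eq′ ← ∷-injective eq = cong (x ∷_) (tail-inj eq′)

  removeAt-suc-injective : ∀ {t u d} (p : Fin t → Vec A (suc (suc d)))
                           (q : Fin u → Vec A (suc d)) {j} →
                           (∀ c → ∃ λ c′ → removeAt (p c) zero ≡ q c′) →
                           RemoveAtInjective q j → RemoveAtInjective p (suc j)
  removeAt-suc-injective p q {j} covered q-inj b c eq =
    removeAt-suc-cancel (p b) (p c) j eq λ eq′ →
      let b′ , pb≡ = covered b ; c′ , pc≡ = covered c in
      trans pb≡ (trans (q-inj b′ c′ (subst₂ (λ u w → removeAt u j ≡ removeAt w j) pb≡ pc≡ eq′))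
                       (sym pc≡))

  tails-punchIn : ∀ {t d} (p : Fin (suc t) → Vec A (suc d)) {b c} →
                  removeAt (p c) zero ≡ removeAt (p b) zero → c ≢ b →
                  ∀ e → ∃ λ e′ → removeAt (p e) zero ≡ removeAt (p (punchIn b e′)) zero
  tails-punchIn p {b} {c} tails≡ c≢b e with b Fin.≟ e
  ... | yes refl = punchOut (c≢b ∘ sym) ,
                   trans (sym tails≡) (cong (λ z → removeAt (p z) zero) (sym (punchIn-punchOut _)))
  ... | no b≢e   = punchOut b≢e , cong (λ z → removeAt (p z) zero) (sym (punchIn-punchOut b≢e))

  removableCoordinate : ∀ {t d} → t ≤ suc d → (p : Fin t → Vec A (suc d)) →
                        ∃ (RemoveAtInjective p)
  tailCollision⇒removableCoordinate : ∀ {t d} → t ≤ suc d → (p : Fin t → Vec A (suc d)) →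
                                      TailCollision p → ∃ (RemoveAtInjective p)

  removableCoordinate t≤ p with tailCollision? p
  ... | yes collision  = tailCollision⇒removableCoordinate t≤ p collision
  ... | no noCollision = zero , ¬TailCollision⇒RemoveAtInjective p noCollision

  tailCollision⇒removableCoordinate {zero} _ _ (() , _)
  tailCollision⇒removableCoordinate {suc zero} {zero} _ _ (zero , zero , _ , pb≢pc) =
    contradiction refl pb≢pc
  tailCollision⇒removableCoordinate {suc (suc _)} {zero} (s≤s ())
  tailCollision⇒removableCoordinate {suc t} {suc d} (s≤s t≤) p (b , c , tails≡ , pb≢pc) =
    map suc (removeAt-suc-injective p q (tails-punchIn p (sym tails≡) (pb≢pc ∘ cong p ∘ sym)))
        (removableCoordinate t≤ q)
    where
    q : Fin t → Vec A (suc d)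
    q e = removeAt (p (punchIn b e)) zero

funToFin-cong : ∀ {m n} {f g : Fin m → Fin n} → (∀ i → f i ≡ g i) → funToFin f ≡ funToFin g
funToFin-cong {zero}  f≗g = refl
funToFin-cong {suc m} f≗g = cong₂ combine (f≗g zero) (funToFin-cong (f≗g ∘ suc))

^↔Vec : ∀ {n d} → Fin (n ^ d) ↔ Vec (Fin n) d
^↔Vec {n} {d} = mk↔ₛ′ (tabulate ∘ finToFun) (funToFin ∘ lookup)
  (λ v → trans (tabulate-cong (finToFun-funToFin (lookup v))) (tabulate∘lookup v))
  (λ x → trans (funToFin-cong {d} {n} (lookup∘tabulate (finToFun x))) (funToFin-finToFin {d} {n} x))

removeAt↔ : ∀ {a} {A : Set a} {d} → Fin (suc d) → Vec A (suc d) ↔ (Vec A d × A)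
removeAt↔ i = mk↔ₛ′ (λ v → removeAt v i , lookup v i) (λ (w , x) → insertAt w i x)
  (λ (w , x) → cong₂ _,_ (removeAt-insertAt w i x) (insertAt-lookup w i x))
  (λ v → insertAt-removeAt v i)

removeDigit↔ : ∀ {n d} → Fin (suc d) → Fin (n ^ suc d) ↔ (Fin (n ^ d) × Fin n)
removeDigit↔ i = ↔-trans ^↔Vec (↔-trans (removeAt↔ i) (↔-sym ^↔Vec ×-↔ ↔-refl))

removableDigit : ∀ {n d} (x : Fin (suc d) → Fin (n ^ suc d)) → Injective _≡_ _≡_ x →
                 ∃ λ i → Injective _≡_ _≡_ (proj₁ ∘ Inverse.to (removeDigit↔ i) ∘ x)
removableDigit {n} x x-inj =
  map₂ (λ removeAt-inj eq → x-inj (decode-inj (removeAt-inj _ _ (encode-inj eq))))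
       (removableCoordinate Fin._≟_ ≤-refl (Inverse.to ^↔Vec ∘ x))
  where
  decode-inj : ∀ {d} → Injective _≡_ _≡_ (Inverse.to (^↔Vec {n} {d}))
  decode-inj = Injection.injective (↔⇒↣ ^↔Vec)
  encode-inj : ∀ {d} → Injective _≡_ _≡_ (Inverse.from (^↔Vec {n} {d}))
  encode-inj = Injection.injective (↔⇒↣ (↔-sym ^↔Vec))

lexOrder : ∀ {N m r} → Fin N ↔ (Fin m × Fin r) → Permutation′ m → Permutation′ N
lexOrder e π = lex ∘ₚ cast-id (sym (↔⇒≡ lex))
  where
  lex = ↔-trans e (↔-trans (π ×-↔ ↔-refl) (↔-sym *↔×))

lexOrder-< : ∀ {N m r} (e : Fin N ↔ (Fin m × Fin r)) (π : Permutation′ m) {x y} →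
             π ⟨$⟩ʳ proj₁ (Inverse.to e x) < π ⟨$⟩ʳ proj₁ (Inverse.to e y) →
             lexOrder e π ⟨$⟩ʳ x < lexOrder e π ⟨$⟩ʳ y
lexOrder-< e π lt =
  subst₂ ℕ._<_ (sym (toℕ-cast _ _)) (sym (toℕ-cast _ _)) (combine-monoˡ-< _ _ lt)

lexOrder-shatters : ∀ {N m r S k} (e : Fin N ↔ (Fin m × Fin r)) (F : Fin S → Permutation′ m) →
                    ShattersAll k F → (x : Fin k → Fin N) →
                    Injective _≡_ _≡_ (proj₁ ∘ Inverse.to e ∘ x) → Shatters (lexOrder e ∘ F) x
lexOrder-shatters e F shatters x inj σ =
  map₂ (λ realises i j i<j → lexOrder-< e (F _) (realises i j i<j)) (shatters _ inj σ)

digitFamily : ∀ {n d S} → (Fin S → Permutation′ (n ^ d)) → Fin (suc d * S) → Permutation′ (n ^ suc d)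
digitFamily {n} {d} {S} F j = let i , s = remQuot S j in lexOrder (removeDigit↔ {n} {d} i) (F s)

digitFamily-shatters : ∀ {n d S} (F : Fin S → Permutation′ (n ^ d)) →
                       ShattersAll (suc d) F → ShattersAll (suc d) (digitFamily {n} {d} F)
digitFamily-shatters {n} {d} F shatters x x-inj σ =
  let i , removeDigit-inj = removableDigit {n} {d} x x-inj
      s , realises = lexOrder-shatters (removeDigit↔ i) F shatters x removeDigit-inj σ
  in combine i s ,
     subst (λ (i , s) → Realises (lexOrder (removeDigit↔ {n} {d} i) (F s)) x σ)
           (sym (remQuot-combine i s)) realises

lemma4p1 : (k n S : ℕ) → 2 ≤ k → 1 ≤ n →
    (∃ λ (F : Fin S → Permutation′ (n ^ (k ∸ 1))) → ShattersAll k F) →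
    ∃ λ (G : Fin (k * S) → Permutation′ (n ^ k)) → ShattersAll k G
-- The construction works for every k ≥ 1 and every n; 2 ≤ k only rules out k = 0.
lemma4p1 zero _ _ ()
lemma4p1 (suc d) n S _ _ (F , shatters) = digitFamily {n} {d} F , digitFamily-shatters {n} {d} F shatters
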